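{- Let $\mathbf E=(E,+,{}',0,1)$ be an effect algebra with induced order $\leq$ and let $a,b,c\in E$. Then: (i) $a\rightarrow b\subseteq U(a')$; (ii) if $a\leq b$ then $a\rightarrow b=U(a')$; (iii) if $b\leq a$ then $a\rightarrow b=[a',a'+b]$; (iv) $0\rightarrow b=\{1\}$; (v) $a\rightarrow 0=\{a'\}$; (vi) $1\rightarrow b=L(b)$; (vii) $L(a\rightarrow b)=L(a')$; (viii) $a\cdot(a\rightarrow b)=L(a,b)$; (ix) if $b\leq c$ then $a\rightarrow b\subseteq a\rightarrow c$; (x) $a\rightarrow b=(a\cdot(L(a,b))')'=(a\cdot U(a',b'))'$; (xi) $a\rightarrow b\leq U(a',c')$ if and only if $a\rightarrow c\leq U(a',b')$; (xii) if $\mathbf E$ is a lattice effect algebra then $a\rightarrow(a\wedge b)=a\rightarrow b$.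
   Context: An effect algebra is a partial algebra $(E,+,{}',0,1)$ of type $(2,1,0,0)$ where $+$ is a partial binary operation such that for all $x,y,z\in E$: (E1) $x+y$ is defined iff $y+x$ is defined, and then $x+y=y+x$; (E2) $(x+y)+z$ is defined iff $x+(y+z)$ is defined, and then they are equal; (E3) $x'$ is the unique $u\in E$ with $x+u=1$; (E4) if $1+x$ is defined then $x=0$. The induced order is $x\leq y$ iff $x+z=y$ for some $z\in E$; it makes $E$ a bounded poset, and $x+y$ is defined iff $x\leq y'$. A lattice effect algebra is one whose induced order is a lattice. For $A\subseteq E$, $L(A)=\{x\mid x\leq y\ \forall y\in A\}$, $U(A)=\{x\mid y\leq x\ \forall y\in A\}$; $L(a,b)=L(\{a,b\})$, $L(a)=L(\{a\})$, etc. $[a,b]=\{x\mid a\leq x\leq b\}$. For subsets $A,B$ and an element $x$: $A\leq B$ means $u\leq v$ for all $u\in A,v\in B$ (similarly $A\leq x$); $A'=\{u'\mid u\in A\}$; if $A\leq x'$ then $x+A=\{x+u\mid u\in A\}$. Define $x\cdot y:=(x'+y')'$, defined exactly when $x'\leq y$; for a set $A$ with $x'\leq A$, $x\cdot A=\{x\cdot u\mid u\in A\}$. Implication: $x\rightarrow y:=x'+L(x,y)$ (a subset of $E$). -}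

module Defs where

open import Level using (Level; _⊔_) renaming (suc to lsuc)
open import Data.Product using (Σ; _×_; _,_; ∃; ∃-syntax)
open import Relation.Binary.PropositionalEquality using (_≡_)
open import Relation.Unary using (Pred; _∈_)

-- An effect algebra (E, +, ', 0, 1).  The partial operation + is encoded as a
-- ternary relation  Sum x y z  meaning "x + y is defined and x + y = z".
record EffectAlgebra (ℓ : Level) : Set (lsuc ℓ) where
  field
    Carrier : Set ℓ
    Sum     : Carrier → Carrier → Carrier → Set ℓ
    _′      : Carrier → Carrier
    𝟘 𝟙     : Carrier
    Sum-functional : ∀ {x y z w} → Sum x y z → Sum x y w → z ≡ w
    E1 : ∀ {x y z} → Sum x y z → Sum y x z
    E2 : ∀ {x y z u w} → Sum x y u → Sum u z w → Σ Carrier λ v → Sum y z v × Sum x v w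
    E2′ : ∀ {x y z v w} → Sum y z v → Sum x v w → Σ Carrier λ u → Sum x y u × Sum u z w
    E3-sum    : ∀ x → Sum x (x ′) 𝟙
    E3-unique : ∀ {x u} → Sum x u 𝟙 → u ≡ x ′
    E4 : ∀ {x z} → Sum 𝟙 x z → x ≡ 𝟘

  infix 4 _≤_
  _≤_ : Carrier → Carrier → Set ℓ
  x ≤ y = Σ Carrier λ z → Sum x z y

  L : Pred Carrier ℓ → Pred Carrier ℓ
  L A x = ∀ y → y ∈ A → x ≤ y

  U : Pred Carrier ℓ → Pred Carrier ℓ
  U A x = ∀ y → y ∈ A → y ≤ x

  pair : Carrier → Carrier → Pred Carrier ℓ
  pair a b y = (y ≡ a) Data.Sum.⊎ (y ≡ b)
    where import Data.Sum

  single : Carrier → Pred Carrier ℓ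
  single a y = y ≡ a

  L₂ U₂ : Carrier → Carrier → Pred Carrier ℓ
  L₂ a b = L (pair a b)
  U₂ a b = U (pair a b)

  L₁ U₁ : Carrier → Pred Carrier ℓ
  L₁ a = L (single a)
  U₁ a = U (single a)

  Interval : Carrier → Carrier → Pred Carrier ℓ
  Interval a b x = (a ≤ x) × (x ≤ b)

  _≤ˢ_ : Pred Carrier ℓ → Pred Carrier ℓ → Set ℓ
  A ≤ˢ B = ∀ u v → u ∈ A → v ∈ B → u ≤ v

  _ᶜ : Pred Carrier ℓ → Pred Carrier ℓ
  (A ᶜ) w = Σ Carrier λ u → u ∈ A × w ≡ u ′

  _+ˢ_ : Carrier → Pred Carrier ℓ → Pred Carrier ℓ
  (x +ˢ A) w = Σ Carrier λ u → u ∈ A × Sum x u w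

  -- x · y := (x' + y')'  ;  x · A = { x · u | u ∈ A }
  _·ˢ_ : Carrier → Pred Carrier ℓ → Pred Carrier ℓ
  (x ·ˢ A) w = Σ Carrier λ u → u ∈ A × Σ Carrier λ s → Sum (x ′) (u ′) s × w ≡ s ′

  _⇒_ : Carrier → Carrier → Pred Carrier ℓ
  x ⇒ y = (x ′) +ˢ L₂ x y

  record IsLattice : Set ℓ where
    field
      _∧_ _∨_ : Carrier → Carrier → Carrier
      ∧-lb₁ : ∀ x y → (x ∧ y) ≤ x
      ∧-lb₂ : ∀ x y → (x ∧ y) ≤ y
      ∧-glb : ∀ x y z → z ≤ x → z ≤ y → z ≤ (x ∧ y)
      ∨-ub₁ : ∀ x y → x ≤ (x ∨ y)
      ∨-ub₂ : ∀ x y → y ≤ (x ∨ y)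
      ∨-lub : ∀ x y z → x ≤ z → y ≤ z → (x ∨ y) ≤ z

module Submission where

-- The implication a → b = a′ + L(a,b) is a translate of the cone L(a,b), so every item reduces
-- to a statement about translates x + A of subsets, together with a description of L(a,b) in
-- the special cases at hand.  What makes translates tractable is cancellativity of + and the
-- rotation law x + y = w ⇒ w′ + x = y′, which links + with · and with complementation.

open import Defs
open import Level using (Level)
open import Data.Product using (Σ; _×_; _,_)
open import Data.Sum using (inj₁; inj₂)
open import Relation.Unary using (Pred; _∈_; _⊆_; _≐_; ｛_｝)
open import Relation.Unary.Properties using (≐-sym; ≐-trans)
open import Function.Bundles using (_⇔_; mk⇔)
open import Relation.Binary.PropositionalEquality using (_≡_; refl; sym; trans; cong; subst)

module EffectAlgebraProperties {ℓ : Level} (𝐄 : EffectAlgebra ℓ) where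
  open EffectAlgebra 𝐄

  variable
    a b c s u v w x y z : Carrier
    A B : Pred Carrier ℓ

  ′-involutive : ∀ x → x ′ ′ ≡ x
  ′-involutive x = sym (E3-unique (E1 (E3-sum x)))

  ′-injective : x ′ ≡ y ′ → x ≡ y
  ′-injective {x} {y} eq = trans (sym (′-involutive x)) (trans (cong _′ eq) (′-involutive y))

  Sum-′ : Sum x y w → Sum y (w ′) (x ′)
  Sum-′ {x} {y} {w} sum with E2 sum (E3-sum w)
  ... | v , y+w′ , x+v = subst (Sum y (w ′)) (E3-unique x+v) y+w′

  Sum-rotate : Sum x y w → Sum (w ′) x (y ′)
  Sum-rotate {x} {y} {w} sum = subst (λ z → Sum (w ′) z (y ′)) (′-involutive x) (Sum-′ (Sum-′ sum))

  Sum-cancelˡ : Sum x y w → Sum x z w → y ≡ z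
  Sum-cancelˡ s₁ s₂ = ′-injective (Sum-functional (Sum-rotate s₁) (Sum-rotate s₂))

  𝟙′≡𝟘 : 𝟙 ′ ≡ 𝟘
  𝟙′≡𝟘 = E4 (E3-sum 𝟙)

  𝟘′≡𝟙 : 𝟘 ′ ≡ 𝟙
  𝟘′≡𝟙 = trans (cong _′ (sym 𝟙′≡𝟘)) (′-involutive 𝟙)

  Sum-identityʳ : ∀ x → Sum x 𝟘 x
  Sum-identityʳ x = subst (λ z → Sum z 𝟘 z) (′-involutive x)
    (subst (λ z → Sum (x ′ ′) z (x ′ ′)) 𝟙′≡𝟘 (Sum-′ (E3-sum (x ′))))

  Sum-identityˡ : ∀ x → Sum 𝟘 x x
  Sum-identityˡ x = E1 (Sum-identityʳ x)

  ≤-refl : ∀ x → x ≤ x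
  ≤-refl x = 𝟘 , Sum-identityʳ x

  ≤-trans : x ≤ y → y ≤ z → x ≤ z
  ≤-trans (_ , x+t) (_ , y+r) with E2 x+t y+r
  ... | v , _ , x+v = v , x+v

  𝟘≤ : ∀ x → 𝟘 ≤ x
  𝟘≤ x = x , Sum-identityˡ x

  ≤𝟘⇒≡𝟘 : x ≤ 𝟘 → x ≡ 𝟘
  ≤𝟘⇒≡𝟘 {x} (t , x+t) = E4 (subst (λ z → Sum z x (t ′)) 𝟘′≡𝟙 (Sum-rotate x+t))

  ≤𝟙 : ∀ x → x ≤ 𝟙
  ≤𝟙 x = x ′ , E3-sum x

  Sum⇒≤′ : Sum x y w → y ≤ x ′
  Sum⇒≤′ {w = w} sum = w ′ , Sum-′ sum

  Sum′⇒≤ : Sum (x ′) y w → y ≤ x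
  Sum′⇒≤ {x} {y} sum = subst (y ≤_) (′-involutive x) (Sum⇒≤′ sum)

  ≤′⇒Sum : x ≤ y ′ → Σ Carrier (Sum x y)
  ≤′⇒Sum {y = y} (_ , x+t) with E2 (E1 x+t) (E1 (E3-sum y))
  ... | v , x+y , _ = v , x+y

  ′-antitone : x ≤ y → y ′ ≤ x ′
  ′-antitone (t , x+t) = t , E1 (Sum-′ x+t)

  Sum-monoʳ-≤ : Sum x u w → Sum x v s → u ≤ v → w ≤ s
  Sum-monoʳ-≤ x+u x+v (t , u+t) with E2′ u+t x+v
  ... | _ , x+u′ , w+t = t , subst (λ z → Sum z t _) (Sum-functional x+u′ x+u) w+t

  -- u ≤ z′ says that (x + y) + z is defined; reassociating, so is (x + z) + y.
  Sum-⊥-swap : Sum x y u → Sum x z v → u ≤ z ′ → v ≤ y ′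
  Sum-⊥-swap {y = y} x+y x+z u⊥z with ≤′⇒Sum u⊥z
  ... | _ , u+z with E2 x+y u+z
  ... | _ , y+z , x+[y+z] with E2′ (E1 y+z) x+[y+z]
  ... | _ , x+z′ , [x+z]+y =
    subst (_≤ y ′) (Sum-functional x+z′ x+z) (Sum⇒≤′ (E1 [x+z]+y))

  L₁-intro : x ≤ a → x ∈ L₁ a
  L₁-intro x≤a _ refl = x≤a

  L₁⇒≤ : x ∈ L₁ a → x ≤ a
  L₁⇒≤ h = h _ refl

  U₁-intro : a ≤ x → x ∈ U₁ a
  U₁-intro a≤x _ refl = a≤x

  U₁⇒≥ : x ∈ U₁ a → a ≤ x
  U₁⇒≥ h = h _ refl

  L₂-intro : x ≤ a → x ≤ b → x ∈ L₂ a b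
  L₂-intro x≤a _ _ (inj₁ refl) = x≤a
  L₂-intro _ x≤b _ (inj₂ refl) = x≤b

  L₂⇒≤ˡ : x ∈ L₂ a b → x ≤ a
  L₂⇒≤ˡ h = h _ (inj₁ refl)

  L₂⇒≤ʳ : x ∈ L₂ a b → x ≤ b
  L₂⇒≤ʳ h = h _ (inj₂ refl)

  U₂-intro : a ≤ x → b ≤ x → x ∈ U₂ a b
  U₂-intro a≤x _ _ (inj₁ refl) = a≤x
  U₂-intro _ b≤x _ (inj₂ refl) = b≤x

  L₂-comm : L₂ a b ≐ L₂ b a
  L₂-comm = flip , flip
    where
    flip : ∀ {a b} → L₂ a b ⊆ L₂ b a
    flip h = L₂-intro (L₂⇒≤ʳ h) (L₂⇒≤ˡ h)

  L₂-monoʳ : b ≤ c → L₂ a b ⊆ L₂ a c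
  L₂-monoʳ b≤c h = L₂-intro (L₂⇒≤ˡ h) (≤-trans (L₂⇒≤ʳ h) b≤c)

  L₂-≤ : a ≤ b → L₂ a b ≐ L₁ a
  L₂-≤ a≤b = (λ h → L₁-intro (L₂⇒≤ˡ h))
           , (λ h → L₂-intro (L₁⇒≤ h) (≤-trans (L₁⇒≤ h) a≤b))

  L₁-𝟘 : L₁ 𝟘 ≐ ｛ 𝟘 ｝
  L₁-𝟘 = (λ h → sym (≤𝟘⇒≡𝟘 (L₁⇒≤ h))) , λ { refl → L₁-intro (≤-refl 𝟘) }

  L₂⇒U₂′ : x ∈ L₂ a b → x ′ ∈ U₂ (a ′) (b ′)
  L₂⇒U₂′ h = U₂-intro (′-antitone (L₂⇒≤ˡ h)) (′-antitone (L₂⇒≤ʳ h))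

  U₂′⇒L₂ : x ∈ U₂ (a ′) (b ′) → x ′ ∈ L₂ a b
  U₂′⇒L₂ {a = a} {b} h = L₂-intro (flip (h _ (inj₁ refl))) (flip (h _ (inj₂ refl)))
    where
    flip : ∀ {x y} → x ′ ≤ y → y ′ ≤ x
    flip {x} {y} p = subst (y ′ ≤_) (′-involutive x) (′-antitone p)

  U₂′-ᶜ : (U₂ (a ′) (b ′)) ᶜ ≐ L₂ a b
  U₂′-ᶜ = (λ { (_ , h , refl) → U₂′⇒L₂ h })
        , λ {x} h → x ′ , L₂⇒U₂′ h , sym (′-involutive x)

  ᶜ-involutive : (A ᶜ) ᶜ ≐ A
  ᶜ-involutive {A} = (λ { (_ , (u , h , refl) , refl) → subst A (sym (′-involutive u)) h })
                   , λ {x} h → x ′ , (x , h , refl) , sym (′-involutive x)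

  +ˢ-mono : A ⊆ B → x +ˢ A ⊆ x +ˢ B
  +ˢ-mono A⊆B (u , h , sum) = u , A⊆B h , sum

  +ˢ-cong : A ≐ B → x +ˢ A ≐ x +ˢ B
  +ˢ-cong (A⊆B , B⊆A) = +ˢ-mono A⊆B , +ˢ-mono B⊆A

  +ˢ⊆U₁ : x +ˢ A ⊆ U₁ x
  +ˢ⊆U₁ (u , _ , sum) = U₁-intro (u , sum)

  𝟘-+ˢ : 𝟘 +ˢ A ≐ A
  𝟘-+ˢ {A} = (λ { (u , h , sum) → subst A (Sum-functional (Sum-identityˡ u) sum) h })
           , λ h → _ , h , Sum-identityˡ _

  +ˢ-｛𝟘｝ : x +ˢ ｛ 𝟘 ｝ ≐ ｛ x ｝
  +ˢ-｛𝟘｝ {x} = (λ { (_ , refl , sum) → Sum-functional (Sum-identityʳ x) sum })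
               , λ { refl → 𝟘 , refl , Sum-identityʳ x }

  ′-+ˢ-L₁ : (x ′) +ˢ L₁ x ≐ U₁ (x ′)
  ′-+ˢ-L₁ = +ˢ⊆U₁ , λ h → let (t , sum) = U₁⇒≥ h in t , L₁-intro (Sum′⇒≤ sum) , sum

  +ˢ-L₁ : Sum x y s → x +ˢ L₁ y ≐ Interval x s
  +ˢ-L₁ {x} {y} {s} x+y = (λ { (u , h , x+u) → (u , x+u) , Sum-monoʳ-≤ x+u x+y (L₁⇒≤ h) }) , fromInterval
    where
    fromInterval : Interval x s ⊆ (x +ˢ L₁ y)
    fromInterval ((t , x+t) , (r , w+r)) with E2 x+t w+r
    ... | _ , t+r , x+[t+r] =
      t , L₁-intro (r , subst (Sum t r) (Sum-cancelˡ x+[t+r] x+y) t+r) , x+t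

  L-+ˢ : 𝟘 ∈ A → L (x +ˢ A) ≐ L₁ x
  L-+ˢ {x = x} 𝟘∈A = (λ h → L₁-intro (h x (𝟘 , 𝟘∈A , Sum-identityʳ x)))
                   , λ { h _ (u , _ , sum) → ≤-trans (L₁⇒≤ h) (u , sum) }

  ·ˢ-ᶜ : (x ·ˢ A) ᶜ ≐ (x ′) +ˢ (A ᶜ)
  ·ˢ-ᶜ {x} = (λ { (_ , (u , h , s , sum , refl) , refl) →
                   u ′ , (u , h , refl) , subst (Sum (x ′) (u ′)) (sym (′-involutive s)) sum })
           , λ { {w} (_ , (u , h , refl) , sum) → w ′ , (u , h , w , sum , refl) , sym (′-involutive w) }

  -- · undoes the translation by x′, as x′ + v = u gives (x′ + u′)′ = v by rotation.
  ·ˢ-+ˢ : A ⊆ L₁ x → x ·ˢ ((x ′) +ˢ A) ≐ A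
  ·ˢ-+ˢ {A} {x} A≤x = undo , redo
    where
    undo : x ·ˢ ((x ′) +ˢ A) ⊆ A
    undo (u , (v , h , x′+v) , s , x′+u′ , refl) =
      subst A (trans (sym (′-involutive v)) (cong _′ (Sum-functional (Sum-rotate x′+v) (E1 x′+u′)))) h
    redo : A ⊆ (x ·ˢ ((x ′) +ˢ A))
    redo {v} h with ≤′⇒Sum {v} {x ′} (subst (v ≤_) (sym (′-involutive x)) (L₁⇒≤ (A≤x h)))
    ... | u , v+x′ = u , (v , h , E1 v+x′) , v ′ , E1 (Sum-rotate (E1 v+x′)) , sym (′-involutive v)

  ⇒⊆U₁ : (a ⇒ b) ⊆ U₁ (a ′)
  ⇒⊆U₁ = +ˢ⊆U₁

  ⇒-≤ : a ≤ b → (a ⇒ b) ≐ U₁ (a ′)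
  ⇒-≤ a≤b = ≐-trans (+ˢ-cong (L₂-≤ a≤b)) ′-+ˢ-L₁

  ⇒-≥ : b ≤ a → Σ Carrier λ s → Sum (a ′) b s × ((a ⇒ b) ≐ Interval (a ′) s)
  ⇒-≥ b≤a with ≤′⇒Sum (′-antitone b≤a)
  ... | s , a′+b = s , a′+b , ≐-trans (+ˢ-cong (≐-trans L₂-comm (L₂-≤ b≤a))) (+ˢ-L₁ a′+b)

  𝟘⇒ : (𝟘 ⇒ b) ≐ ｛ 𝟙 ｝
  𝟘⇒ {b} = subst (λ z → (𝟘 ⇒ b) ≐ ｛ z ｝) 𝟘′≡𝟙
    (≐-trans (+ˢ-cong (≐-trans (L₂-≤ (𝟘≤ b)) L₁-𝟘)) +ˢ-｛𝟘｝)

  ⇒𝟘 : (a ⇒ 𝟘) ≐ ｛ a ′ ｝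
  ⇒𝟘 {a} = ≐-trans (+ˢ-cong (≐-trans L₂-comm (≐-trans (L₂-≤ (𝟘≤ a)) L₁-𝟘))) +ˢ-｛𝟘｝

  𝟙⇒ : (𝟙 ⇒ b) ≐ L₁ b
  𝟙⇒ {b} = ≐-trans (+ˢ-cong (≐-trans L₂-comm (L₂-≤ (≤𝟙 b))))
    (subst (λ z → z +ˢ L₁ b ≐ L₁ b) (sym 𝟙′≡𝟘) 𝟘-+ˢ)

  L-⇒ : L (a ⇒ b) ≐ L₁ (a ′)
  L-⇒ {a} {b} = L-+ˢ (L₂-intro (𝟘≤ a) (𝟘≤ b))

  ·ˢ-⇒ : (a ·ˢ (a ⇒ b)) ≐ L₂ a b
  ·ˢ-⇒ = ·ˢ-+ˢ (λ h → L₁-intro (L₂⇒≤ˡ h))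

  ⇒-monoʳ : b ≤ c → (a ⇒ b) ⊆ (a ⇒ c)
  ⇒-monoʳ b≤c = +ˢ-mono (L₂-monoʳ b≤c)

  ⇒-·ˢ-Lᶜ : (a ⇒ b) ≐ ((a ·ˢ (L₂ a b ᶜ)) ᶜ)
  ⇒-·ˢ-Lᶜ = ≐-sym (≐-trans ·ˢ-ᶜ (+ˢ-cong ᶜ-involutive))

  ⇒-·ˢ-U : (a ⇒ b) ≐ ((a ·ˢ U₂ (a ′) (b ′)) ᶜ)
  ⇒-·ˢ-U = ≐-sym (≐-trans ·ˢ-ᶜ (+ˢ-cong U₂′-ᶜ))

  -- For w = a′ + r ∈ a → c and Y ∈ U(a′,b′): a′ + Y′ ∈ a → b and r′ ∈ U(a′,c′), so the hypothesis
  -- gives a′ + Y′ ≤ r′, which Sum-⊥-swap turns into w ≤ Y′′ = Y.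
  ⇒-≤ˢ-U₂-swap : (a ⇒ b) ≤ˢ U₂ (a ′) (c ′) → (a ⇒ c) ≤ˢ U₂ (a ′) (b ′)
  ⇒-≤ˢ-U₂-swap H w Y (r , r∈L , a′+r) Y∈U with U₂′⇒L₂ Y∈U
  ... | Y′∈L with ≤′⇒Sum (′-antitone (L₂⇒≤ˡ Y′∈L))
  ... | w₀ , a′+Y′ = subst (w ≤_) (′-involutive Y)
    (Sum-⊥-swap a′+Y′ a′+r (H w₀ (r ′) (Y ′ , Y′∈L , a′+Y′) (L₂⇒U₂′ r∈L)))

  ⇒-∧ʳ : (lat : IsLattice) → (a ⇒ IsLattice._∧_ lat a b) ≐ (a ⇒ b)
  ⇒-∧ʳ {a} {b} lat = +ˢ-cong (L₂-monoʳ (∧-lb₂ a b) , L₂-∧-glb)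
    where
    open IsLattice lat
    L₂-∧-glb : L₂ a b ⊆ L₂ a (a ∧ b)
    L₂-∧-glb h = L₂-intro (L₂⇒≤ˡ h) (∧-glb a b _ (L₂⇒≤ˡ h) (L₂⇒≤ʳ h))

theorem4 : ∀ {ℓ : Level} (𝐄 : EffectAlgebra ℓ) → let open EffectAlgebra 𝐄 in
    ∀ (a b c : Carrier) →
      ((a ⇒ b) ⊆ U₁ (a ′))
    × (a ≤ b → (a ⇒ b) ≐ U₁ (a ′))
    × (b ≤ a → Σ Carrier λ s → Sum (a ′) b s × ((a ⇒ b) ≐ Interval (a ′) s))
    × ((𝟘 ⇒ b) ≐ ｛ 𝟙 ｝)
    × ((a ⇒ 𝟘) ≐ ｛ a ′ ｝)
    × ((𝟙 ⇒ b) ≐ L₁ b)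
    × (L (a ⇒ b) ≐ L₁ (a ′))
    × ((a ·ˢ (a ⇒ b)) ≐ L₂ a b)
    × (b ≤ c → (a ⇒ b) ⊆ (a ⇒ c))
    × (((a ⇒ b) ≐ ((a ·ˢ (L₂ a b ᶜ)) ᶜ)) × ((a ⇒ b) ≐ ((a ·ˢ U₂ (a ′) (b ′)) ᶜ)))
    × (((a ⇒ b) ≤ˢ U₂ (a ′) (c ′)) ⇔ ((a ⇒ c) ≤ˢ U₂ (a ′) (b ′)))
    × ((lat : IsLattice) → (a ⇒ IsLattice._∧_ lat a b) ≐ (a ⇒ b))
theorem4 𝐄 a b c =
    ⇒⊆U₁ , ⇒-≤ , ⇒-≥ , 𝟘⇒ , ⇒𝟘 , 𝟙⇒ , L-⇒ , ·ˢ-⇒ , ⇒-monoʳ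
  , (⇒-·ˢ-Lᶜ , ⇒-·ˢ-U) , mk⇔ ⇒-≤ˢ-U₂-swap ⇒-≤ˢ-U₂-swap , ⇒-∧ʳ
  where open EffectAlgebraProperties 𝐄
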